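{- Let $K$ be a variety of BL algebras with finitely many additional operators such that $K=V(\mathrm{Fin}(K))$, i.e. $K$ is generated as a variety by its finite members. Suppose $\mathfrak A\in K$ is $K$-freely generated by a finite set $X$, and $\mathfrak A=\mathrm{Sg}^{\mathfrak A}Y$ for some $Y\subseteq A$ with $|Y|=|X|$. Then $\mathfrak A$ is $K$-freely generated by $Y$.
   Context: A BL algebra is a residuated lattice $(L,\cup,\cap,*,\Rightarrow,0,1)$ (bounded lattice, commutative monoid $(L,*,1)$, and $z\le x\Rightarrow y$ iff $x*z\le y$) which is prelinear and satisfies $x*(x\Rightarrow y)=x\cap y$. A BL algebra with operators is a BL algebra expanded by further operations. $\mathrm{Sg}^{\mathfrak A}Y$ is the subalgebra generated by $Y$. $\mathfrak A$ is $K$-freely generated by $X\subseteq A$ if $\mathfrak A\in K$, $X$ generates $\mathfrak A$, and every map from $X$ into any $\mathfrak B\in K$ extends to a homomorphism $\mathfrak A\to\mathfrak B$. -}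

module Defs where

open import Level using (Level; _⊔_; suc; Setω)
open import Relation.Binary.PropositionalEquality using (_≡_)
open import Data.Nat using (ℕ)
open import Data.Fin using (Fin)
open import Data.Product using (Σ; _×_; ∃)
open import Relation.Binary.Core using (Rel)
open import Relation.Binary.Structures using (IsEquivalence)
open import Algebra.Lattice.Structures using (IsLattice)
open import Algebra.Structures using (IsCommutativeMonoid)

-- Signature: BL-algebra operations plus k additional operators, the i-th of arity (ar i).
module _ {k : ℕ} (ar : Fin k → ℕ) where

  data Term (V : Set) : Set where
    var  : V → Term V
    _∪ₜ_ _∩ₜ_ _*ₜ_ _⇒ₜ_ : Term V → Term V → Term V
    0ₜ 1ₜ : Term V
    opₜ  : (i : Fin k) → (Fin (ar i) → Term V) → Term V

  record BLO (c ℓ : Level) : Set (suc (c ⊔ ℓ)) where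
    infix  4 _≈_ _≤_
    infixr 6 _∪_
    infixr 7 _∩_ _*_
    infixr 5 _⇒_
    field
      Carrier : Set c
      _≈_     : Rel Carrier ℓ
      _∪_ _∩_ _*_ _⇒_ : Carrier → Carrier → Carrier
      𝟘 𝟙     : Carrier
      op      : (i : Fin k) → (Fin (ar i) → Carrier) → Carrier
      isLattice : IsLattice _≈_ _∪_ _∩_
      𝟘-bot : ∀ x → (𝟘 ∩ x) ≈ 𝟘
      𝟙-top : ∀ x → (x ∩ 𝟙) ≈ x
      isCommutativeMonoid : IsCommutativeMonoid _≈_ _*_ 𝟙
      ⇒-cong  : ∀ {x x' y y'} → x ≈ x' → y ≈ y' → (x ⇒ y) ≈ (x' ⇒ y')
      op-cong : ∀ i {as bs : Fin (ar i) → Carrier} → (∀ j → as j ≈ bs j) → op i as ≈ op i bs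
    _≤_ : Carrier → Carrier → Set ℓ
    x ≤ y = (x ∩ y) ≈ x
    field
      residuation₁ : ∀ x y z → z ≤ (x ⇒ y) → (x * z) ≤ y
      residuation₂ : ∀ x y z → (x * z) ≤ y → z ≤ (x ⇒ y)
      prelinearity : ∀ x y → ((x ⇒ y) ∪ (y ⇒ x)) ≈ 𝟙
      divisibility : ∀ x y → (x * (x ⇒ y)) ≈ (x ∩ y)

    isEquivalence : IsEquivalence _≈_
    isEquivalence = IsLattice.isEquivalence isLattice

  open BLO

  ⟦_⟧ : ∀ {c ℓ} {V : Set} (A : BLO c ℓ) → Term V → (V → Carrier A) → Carrier A
  ⟦ A ⟧ (var v)   ρ = ρ v
  ⟦ A ⟧ (s ∪ₜ t)  ρ = _∪_ A (⟦ A ⟧ s ρ) (⟦ A ⟧ t ρ)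
  ⟦ A ⟧ (s ∩ₜ t)  ρ = _∩_ A (⟦ A ⟧ s ρ) (⟦ A ⟧ t ρ)
  ⟦ A ⟧ (s *ₜ t)  ρ = _*_ A (⟦ A ⟧ s ρ) (⟦ A ⟧ t ρ)
  ⟦ A ⟧ (s ⇒ₜ t)  ρ = _⇒_ A (⟦ A ⟧ s ρ) (⟦ A ⟧ t ρ)
  ⟦ A ⟧ 0ₜ        ρ = 𝟘 A
  ⟦ A ⟧ 1ₜ        ρ = 𝟙 A
  ⟦ A ⟧ (opₜ i ts) ρ = op A i (λ j → ⟦ A ⟧ (ts j) ρ)

  Satisfies : ∀ {c ℓ} → BLO c ℓ → Term ℕ → Term ℕ → Set (c ⊔ ℓ)
  Satisfies A s t = (ρ : ℕ → Carrier A) → _≈_ A (⟦ A ⟧ s ρ) (⟦ A ⟧ t ρ)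

  -- A set of identities E : a variety K = Mod(E); membership in K.
  Identities : Set₁
  Identities = Term ℕ → Term ℕ → Set

  _∈V_ : ∀ {c ℓ} → BLO c ℓ → Identities → Set (c ⊔ ℓ)
  A ∈V E = ∀ s t → E s t → Satisfies A s t

  Finite : ∀ {c ℓ} → BLO c ℓ → Set (c ⊔ ℓ)
  Finite A = Σ ℕ λ m → Σ (Fin m → Carrier A) λ f → ∀ a → ∃ λ j → _≈_ A (f j) a

  -- K = V(Fin(K)) for K = Mod(E): every identity valid in all finite members
  -- of K is valid in all members of K (i.e. Th(Fin K) ⊆ Th(K)).
  GeneratedByFiniteMembers : Identities → Setω
  GeneratedByFiniteMembers E =
    ∀ s t →
    (∀ {c ℓ} (B : BLO c ℓ) → Finite B → B ∈V E → Satisfies B s t) →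
    ∀ {c ℓ} (B : BLO c ℓ) → B ∈V E → Satisfies B s t

  record IsHom {c₁ ℓ₁ c₂ ℓ₂} (A : BLO c₁ ℓ₁) (B : BLO c₂ ℓ₂)
               (h : Carrier A → Carrier B) : Set (c₁ ⊔ ℓ₁ ⊔ ℓ₂) where
    field
      h-cong : ∀ {x y} → _≈_ A x y → _≈_ B (h x) (h y)
      h-∪ : ∀ x y → _≈_ B (h (_∪_ A x y)) (_∪_ B (h x) (h y))
      h-∩ : ∀ x y → _≈_ B (h (_∩_ A x y)) (_∩_ B (h x) (h y))
      h-* : ∀ x y → _≈_ B (h (_*_ A x y)) (_*_ B (h x) (h y))
      h-⇒ : ∀ x y → _≈_ B (h (_⇒_ A x y)) (_⇒_ B (h x) (h y))
      h-𝟘 : _≈_ B (h (𝟘 A)) (𝟘 B)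
      h-𝟙 : _≈_ B (h (𝟙 A)) (𝟙 B)
      h-op : ∀ i (as : Fin (ar i) → Carrier A) →
             _≈_ B (h (op A i as)) (op B i (λ j → h (as j)))

  data InSg {c ℓ} (A : BLO c ℓ) {n : ℕ} (Y : Fin n → Carrier A) : Carrier A → Set (c ⊔ ℓ) where
    gen  : ∀ i → InSg A Y (Y i)
    resp : ∀ {a b} → _≈_ A a b → InSg A Y a → InSg A Y b
    c∪ : ∀ {a b} → InSg A Y a → InSg A Y b → InSg A Y (_∪_ A a b)
    c∩ : ∀ {a b} → InSg A Y a → InSg A Y b → InSg A Y (_∩_ A a b)
    c* : ∀ {a b} → InSg A Y a → InSg A Y b → InSg A Y (_*_ A a b)
    c⇒ : ∀ {a b} → InSg A Y a → InSg A Y b → InSg A Y (_⇒_ A a b)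
    c𝟘 : InSg A Y (𝟘 A)
    c𝟙 : InSg A Y (𝟙 A)
    cop : ∀ i {as : Fin (ar i) → Carrier A} → (∀ j → InSg A Y (as j)) → InSg A Y (op A i as)

  Generates : ∀ {c ℓ} (A : BLO c ℓ) {n : ℕ} → (Fin n → Carrier A) → Set (c ⊔ ℓ)
  Generates A Y = ∀ a → InSg A Y a

  -- The family indexes a set of exactly n distinct elements.
  InjectiveFamily : ∀ {c ℓ} (A : BLO c ℓ) {n : ℕ} → (Fin n → Carrier A) → Set ℓ
  InjectiveFamily A Y = ∀ i j → _≈_ A (Y i) (Y j) → i ≡ j

  record FreelyGenerated (E : Identities) {c ℓ} (A : BLO c ℓ) {n : ℕ}
                         (X : Fin n → Carrier A) : Setω where
    field
      inK       : A ∈V E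
      generates : Generates A X
      universal : ∀ {c' ℓ'} (B : BLO c' ℓ') → B ∈V E → (f : Fin n → Carrier B) →
                  Σ (Carrier A → Carrier B) λ h → IsHom A B h × (∀ i → _≈_ B (h (X i)) (f i))

module Submission where

open import Defs
open import Data.Nat using (ℕ)
open import Data.Fin using (Fin)

-- Let B be a member of K and f an assignment of the generators Y into B.
-- (1) Since Y generates A, f extends to a homomorphism A → B exactly when B satisfies,
--     under f, every relation s(Y) ≈ t(Y) holding in A.
-- (2) If B is finite, every assignment of Y extends.  Assignments of X (coded by indices
--     into an enumeration of B) form a finite set, and the map sending an assignment u to
--     the values on Y of the homomorphism freely extending u is injective, because
--     homomorphisms agreeing on the generating set Y agree on X.  An injective self-map of
--     a finite set is surjective (pigeonhole on an orbit), so f is such a value.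
-- (3) By (1) and (2) every relation of Y in A holds in all finite members of K; since K is
--     generated by its finite members it holds in all of K, and (1) yields the extension.
-- The equality |X| = |Y| is encoded by indexing both families by Fin n.

open import Level using (_⊔_)
open import Data.Nat using (zero; suc; _+_)
open import Data.Nat.Properties using (n<1+n; m≤n⇒∃[o]m+o≡n; +-suc)
open import Data.Nat.GeneralisedArithmetic using (fold; fold-+)
open import Data.Fin using (toℕ; funToFin; finToFun)
import Data.Fin as F
open import Data.Fin.Properties using (pigeonhole; finToFun-funToFin)
open import Data.Product using (Σ; _×_; _,_; proj₁; proj₂; ∃)
open import Function using (_∘_)
open import Relation.Binary.Bundles using (Setoid)
open import Relation.Binary.PropositionalEquality as ≡ using (_≡_; module ≡-Reasoning)
import Relation.Binary.Reasoning.Setoid as SetoidReasoning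
open import Algebra.Lattice.Structures using (IsLattice)
open import Algebra.Structures using (IsCommutativeMonoid)

fold-reflects : ∀ {a r} {S : Set a} (_~_ : S → S → Set r) (f : S → S) →
                (∀ {s t} → f s ~ f t → s ~ t) →
                ∀ i {s t} → fold s f i ~ fold t f i → s ~ t
fold-reflects _~_ f reflects zero    p = p
fold-reflects _~_ f reflects (suc i) p = fold-reflects _~_ f reflects i (reflects p)

-- Two of the first N + 1 points
-- of the orbit of s share a code; cancelling the common iterates leaves s ~ f t.
reflecting-endomap-surjective :
  ∀ {a r} {S : Set a} (_~_ : S → S → Set r) {N : ℕ} (code : S → Fin N) →
  (∀ {s t} → code s ≡ code t → s ~ t) →
  (f : S → S) → (∀ {s t} → f s ~ f t → s ~ t) →
  ∀ s → ∃ λ t → s ~ f t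
reflecting-endomap-surjective _~_ {N} code code-inj f reflects s
  with i , j , i<j , codes-meet ← pigeonhole (n<1+n N) (λ q → code (fold s f (toℕ q)))
  with o , i+1+o≡j ← m≤n⇒∃[o]m+o≡n i<j
  = fold s f o , fold-reflects _~_ f reflects (toℕ i) (code-inj (≡.trans codes-meet (≡.cong code orbit-j)))
  where
  open ≡-Reasoning
  orbit-j : fold s f (toℕ j) ≡ fold (f (fold s f o)) f (toℕ i)
  orbit-j = begin
    fold s f (toℕ j)                ≡⟨ ≡.cong (fold s f) (≡.sym i+1+o≡j) ⟩
    fold s f (suc (toℕ i + o))      ≡⟨ ≡.cong (fold s f) (≡.sym (+-suc (toℕ i) o)) ⟩
    fold s f (toℕ i + suc o)        ≡⟨ fold-+ s f (toℕ i) ⟩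
    fold (f (fold s f o)) f (toℕ i) ∎

module _ {k : ℕ} {ar : Fin k → ℕ} where

  eval : ∀ {c ℓ} {V : Set} (B : BLO ar c ℓ) → Term ar V → (V → BLO.Carrier B) → BLO.Carrier B
  eval = ⟦_⟧ ar

  module Laws {c ℓ} (B : BLO ar c ℓ) where
    open BLO B

    setoid : Setoid c ℓ
    setoid = record { Carrier = Carrier ; _≈_ = _≈_ ; isEquivalence = isEquivalence }

    open Setoid setoid public using (refl; sym; trans; reflexive)

    ∪-cong : ∀ {x x' y y'} → x ≈ x' → y ≈ y' → (x ∪ y) ≈ (x' ∪ y')
    ∪-cong = IsLattice.∨-cong isLattice

    ∩-cong : ∀ {x x' y y'} → x ≈ x' → y ≈ y' → (x ∩ y) ≈ (x' ∩ y')
    ∩-cong = IsLattice.∧-cong isLattice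

    *-cong : ∀ {x x' y y'} → x ≈ x' → y ≈ y' → (x * y) ≈ (x' * y')
    *-cong = IsCommutativeMonoid.∙-cong isCommutativeMonoid

    eval-cong : ∀ {V : Set} (t : Term ar V) {ρ σ : V → Carrier} →
                (∀ v → ρ v ≈ σ v) → eval B t ρ ≈ eval B t σ
    eval-cong (var v)    e = e v
    eval-cong (s ∪ₜ t)   e = ∪-cong (eval-cong s e) (eval-cong t e)
    eval-cong (s ∩ₜ t)   e = ∩-cong (eval-cong s e) (eval-cong t e)
    eval-cong (s *ₜ t)   e = *-cong (eval-cong s e) (eval-cong t e)
    eval-cong (s ⇒ₜ t)   e = ⇒-cong (eval-cong s e) (eval-cong t e)
    eval-cong 0ₜ         e = refl
    eval-cong 1ₜ         e = refl
    eval-cong (opₜ i ts) e = op-cong i (λ j → eval-cong (ts j) e)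

  rename : ∀ {V W : Set} → (V → W) → Term ar V → Term ar W
  rename r (var v)    = var (r v)
  rename r (s ∪ₜ t)   = rename r s ∪ₜ rename r t
  rename r (s ∩ₜ t)   = rename r s ∩ₜ rename r t
  rename r (s *ₜ t)   = rename r s *ₜ rename r t
  rename r (s ⇒ₜ t)   = rename r s ⇒ₜ rename r t
  rename r 0ₜ         = 0ₜ
  rename r 1ₜ         = 1ₜ
  rename r (opₜ i ts) = opₜ i (λ j → rename r (ts j))

  eval-rename : ∀ {c ℓ} (B : BLO ar c ℓ) {V W : Set} (r : V → W) (t : Term ar V)
                (ρ : W → BLO.Carrier B) →
                BLO._≈_ B (eval B (rename r t) ρ) (eval B t (ρ ∘ r))
  eval-rename B r (var v)    ρ = Laws.refl B
  eval-rename B r (s ∪ₜ t)   ρ = Laws.∪-cong B (eval-rename B r s ρ) (eval-rename B r t ρ)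
  eval-rename B r (s ∩ₜ t)   ρ = Laws.∩-cong B (eval-rename B r s ρ) (eval-rename B r t ρ)
  eval-rename B r (s *ₜ t)   ρ = Laws.*-cong B (eval-rename B r s ρ) (eval-rename B r t ρ)
  eval-rename B r (s ⇒ₜ t)   ρ = BLO.⇒-cong B (eval-rename B r s ρ) (eval-rename B r t ρ)
  eval-rename B r 0ₜ         ρ = Laws.refl B
  eval-rename B r 1ₜ         ρ = Laws.refl B
  eval-rename B r (opₜ i ts) ρ = BLO.op-cong B i (λ j → eval-rename B r (ts j) ρ)

  eval-hom : ∀ {c₁ ℓ₁ c₂ ℓ₂} (A : BLO ar c₁ ℓ₁) (B : BLO ar c₂ ℓ₂)
             {h : BLO.Carrier A → BLO.Carrier B} → IsHom ar A B h →
             ∀ {V : Set} (t : Term ar V) (ρ : V → BLO.Carrier A) →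
             BLO._≈_ B (h (eval A t ρ)) (eval B t (h ∘ ρ))
  eval-hom A B H (var v)    ρ = Laws.refl B
  eval-hom A B H (s ∪ₜ t)   ρ =
    Laws.trans B (IsHom.h-∪ H _ _) (Laws.∪-cong B (eval-hom A B H s ρ) (eval-hom A B H t ρ))
  eval-hom A B H (s ∩ₜ t)   ρ =
    Laws.trans B (IsHom.h-∩ H _ _) (Laws.∩-cong B (eval-hom A B H s ρ) (eval-hom A B H t ρ))
  eval-hom A B H (s *ₜ t)   ρ =
    Laws.trans B (IsHom.h-* H _ _) (Laws.*-cong B (eval-hom A B H s ρ) (eval-hom A B H t ρ))
  eval-hom A B H (s ⇒ₜ t)   ρ =
    Laws.trans B (IsHom.h-⇒ H _ _) (BLO.⇒-cong B (eval-hom A B H s ρ) (eval-hom A B H t ρ))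
  eval-hom A B H 0ₜ         ρ = IsHom.h-𝟘 H
  eval-hom A B H 1ₜ         ρ = IsHom.h-𝟙 H
  eval-hom A B H (opₜ i ts) ρ =
    Laws.trans B (IsHom.h-op H i _) (BLO.op-cong B i (λ j → eval-hom A B H (ts j) ρ))

  termOf : ∀ {c ℓ} {A : BLO ar c ℓ} {n} {Y : Fin n → BLO.Carrier A} {a : BLO.Carrier A} →
           InSg ar A Y a → Term ar (Fin n)
  termOf (gen i)    = var i
  termOf (resp _ p) = termOf p
  termOf (c∪ p q)   = termOf p ∪ₜ termOf q
  termOf (c∩ p q)   = termOf p ∩ₜ termOf q
  termOf (c* p q)   = termOf p *ₜ termOf q
  termOf (c⇒ p q)   = termOf p ⇒ₜ termOf q
  termOf c𝟘         = 0ₜ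
  termOf c𝟙         = 1ₜ
  termOf (cop i ps) = opₜ i (λ j → termOf (ps j))

  termOf-sound : ∀ {c ℓ} {A : BLO ar c ℓ} {n} {Y : Fin n → BLO.Carrier A} {a : BLO.Carrier A} →
                 (p : InSg ar A Y a) → BLO._≈_ A (eval A (termOf p) Y) a
  termOf-sound {A = A} (gen i)    = Laws.refl A
  termOf-sound {A = A} (resp e p) = Laws.trans A (termOf-sound p) e
  termOf-sound {A = A} (c∪ p q)   = Laws.∪-cong A (termOf-sound p) (termOf-sound q)
  termOf-sound {A = A} (c∩ p q)   = Laws.∩-cong A (termOf-sound p) (termOf-sound q)
  termOf-sound {A = A} (c* p q)   = Laws.*-cong A (termOf-sound p) (termOf-sound q)
  termOf-sound {A = A} (c⇒ p q)   = BLO.⇒-cong A (termOf-sound p) (termOf-sound q)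
  termOf-sound {A = A} c𝟘         = Laws.refl A
  termOf-sound {A = A} c𝟙         = Laws.refl A
  termOf-sound {A = A} (cop i ps) = BLO.op-cong A i (λ j → termOf-sound (ps j))

  homs-agree : ∀ {c₁ ℓ₁ c₂ ℓ₂} (A : BLO ar c₁ ℓ₁) (B : BLO ar c₂ ℓ₂) {n} {Y : Fin n → BLO.Carrier A}
               {h₁ h₂ : BLO.Carrier A → BLO.Carrier B} → IsHom ar A B h₁ → IsHom ar A B h₂ →
               (∀ i → BLO._≈_ B (h₁ (Y i)) (h₂ (Y i))) →
               ∀ {a} → InSg ar A Y a → BLO._≈_ B (h₁ a) (h₂ a)
  homs-agree A B {n} {Y} {h₁} {h₂} H₁ H₂ agree-on-Y {a} p = begin
    h₁ a              ≈⟨ IsHom.h-cong H₁ (Laws.sym A (termOf-sound p)) ⟩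
    h₁ (eval A t Y)   ≈⟨ eval-hom A B H₁ t Y ⟩
    eval B t (h₁ ∘ Y) ≈⟨ Laws.eval-cong B t agree-on-Y ⟩
    eval B t (h₂ ∘ Y) ≈⟨ Laws.sym B (eval-hom A B H₂ t Y) ⟩
    h₂ (eval A t Y)   ≈⟨ IsHom.h-cong H₂ (termOf-sound p) ⟩
    h₂ a              ∎
    where
    open SetoidReasoning (Laws.setoid B)
    t : Term ar (Fin n)
    t = termOf p

  ExtendsFrom : ∀ {c₁ ℓ₁ c₂ ℓ₂} (A : BLO ar c₁ ℓ₁) {n} → (Fin n → BLO.Carrier A) →
                BLO ar c₂ ℓ₂ → Set (c₁ ⊔ ℓ₁ ⊔ c₂ ⊔ ℓ₂)
  ExtendsFrom A {n} Y B =
    (f : Fin n → BLO.Carrier B) →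
    Σ (BLO.Carrier A → BLO.Carrier B) λ h → IsHom ar A B h × (∀ i → BLO._≈_ B (h (Y i)) (f i))

  ValidIn : ∀ {c ℓ} (B : BLO ar c ℓ) {n} → Term ar (Fin n) → Term ar (Fin n) → Set (c ⊔ ℓ)
  ValidIn B {n} s t = (f : Fin n → BLO.Carrier B) → BLO._≈_ B (eval B s f) (eval B t f)

  RelationsHoldIn : ∀ {c₁ ℓ₁ c₂ ℓ₂} (A : BLO ar c₁ ℓ₁) {n} → (Fin n → BLO.Carrier A) →
                    BLO ar c₂ ℓ₂ → Set (ℓ₁ ⊔ c₂ ⊔ ℓ₂)
  RelationsHoldIn A Y B = ∀ s t → BLO._≈_ A (eval A s Y) (eval A t Y) → ValidIn B s t

  extension⇒relations : ∀ {c₁ ℓ₁ c₂ ℓ₂} {A : BLO ar c₁ ℓ₁} {B : BLO ar c₂ ℓ₂} {n}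
                        {Y : Fin n → BLO.Carrier A} →
                        ExtendsFrom A Y B → RelationsHoldIn A Y B
  extension⇒relations {A = A} {B} {Y = Y} extend s t rel f
    with ψ , ψ-hom , ψ-on-Y ← extend f = begin
    eval B s f       ≈⟨ Laws.eval-cong B s (Laws.sym B ∘ ψ-on-Y) ⟩
    eval B s (ψ ∘ Y) ≈⟨ Laws.sym B (eval-hom A B ψ-hom s Y) ⟩
    ψ (eval A s Y)   ≈⟨ IsHom.h-cong ψ-hom rel ⟩
    ψ (eval A t Y)   ≈⟨ eval-hom A B ψ-hom t Y ⟩
    eval B t (ψ ∘ Y) ≈⟨ Laws.eval-cong B t ψ-on-Y ⟩
    eval B t f       ∎
    where open SetoidReasoning (Laws.setoid B)

  -- Conversely, if Y generates A, an assignment respecting all relations of Y extends: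
  -- send an element to the value under f of any term representing it.
  relations⇒extension : ∀ {c₁ ℓ₁ c₂ ℓ₂} {A : BLO ar c₁ ℓ₁} {B : BLO ar c₂ ℓ₂} {n}
                        {Y : Fin n → BLO.Carrier A} →
                        Generates ar A Y → RelationsHoldIn A Y B → ExtendsFrom A Y B
  relations⇒extension {A = A} {B} {n} {Y} genY relations f =
    h , h-isHom , λ i → h-by-term (Y i) (var i) (Laws.refl A)
    where
    module A = BLO A
    module B = BLO B

    term : A.Carrier → Term ar (Fin n)
    term a = termOf (genY a)

    term-sound : ∀ a → eval A (term a) Y A.≈ a
    term-sound a = termOf-sound (genY a)

    h : A.Carrier → B.Carrier
    h a = eval B (term a) f

    h-by-term : ∀ a t → a A.≈ eval A t Y → h a B.≈ eval B t f
    h-by-term a t a≈t = relations (term a) t (Laws.trans A (term-sound a) a≈t) f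

    h-isHom : IsHom ar A B h
    h-isHom = record
      { h-cong = λ {x} {y} x≈y → h-by-term x (term y) (Laws.trans A x≈y (Laws.sym A (term-sound y)))
      ; h-∪ = λ x y → h-by-term _ (term x ∪ₜ term y)
                (Laws.sym A (Laws.∪-cong A (term-sound x) (term-sound y)))
      ; h-∩ = λ x y → h-by-term _ (term x ∩ₜ term y)
                (Laws.sym A (Laws.∩-cong A (term-sound x) (term-sound y)))
      ; h-* = λ x y → h-by-term _ (term x *ₜ term y)
                (Laws.sym A (Laws.*-cong A (term-sound x) (term-sound y)))
      ; h-⇒ = λ x y → h-by-term _ (term x ⇒ₜ term y)
                (Laws.sym A (A.⇒-cong (term-sound x) (term-sound y)))
      ; h-𝟘 = h-by-term _ 0ₜ (Laws.refl A)
      ; h-𝟙 = h-by-term _ 1ₜ (Laws.refl A)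
      ; h-op = λ i as → h-by-term _ (opₜ i (term ∘ as))
                 (Laws.sym A (A.op-cong i (term-sound ∘ as)))
      }

  finite-extension : ∀ {c₁ ℓ₁ c₂ ℓ₂} {A : BLO ar c₁ ℓ₁} {B : BLO ar c₂ ℓ₂} {n}
                     {X Y : Fin n → BLO.Carrier A} →
                     ExtendsFrom A X B → Generates ar A Y → Finite ar B → ExtendsFrom A Y B
  finite-extension {ℓ₂ = ℓ₂} {A = A} {B} {n} {X} {Y} extend-X genY (m , enum , onto) ρ =
    hom w , hom-isHom w , hom-w-on-Y
    where
    module A = BLO A
    module B = BLO B
    open SetoidReasoning (Laws.setoid B)

    index : B.Carrier → Fin m
    index b = proj₁ (onto b)

    index-correct : ∀ b → enum (index b) B.≈ b
    index-correct b = proj₂ (onto b)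

    Code : Set
    Code = Fin n → Fin m

    _~_ : Code → Code → Set ℓ₂
    u ~ v = ∀ i → enum (u i) B.≈ enum (v i)

    code-injective : ∀ {u v} → funToFin u ≡ funToFin v → u ~ v
    code-injective {u} {v} eq i = Laws.reflexive B (≡.cong enum (≡.trans
      (≡.sym (finToFun-funToFin u i))
      (≡.trans (≡.cong (λ c → finToFun c i) eq) (finToFun-funToFin v i))))

    hom : Code → A.Carrier → B.Carrier
    hom u = proj₁ (extend-X (enum ∘ u))

    hom-isHom : ∀ u → IsHom ar A B (hom u)
    hom-isHom u = proj₁ (proj₂ (extend-X (enum ∘ u)))

    hom-on-X : ∀ u i → hom u (X i) B.≈ enum (u i)
    hom-on-X u i = proj₂ (proj₂ (extend-X (enum ∘ u))) i

    Φ : Code → Code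
    Φ u i = index (hom u (Y i))

    -- Φ is injective: its values determine the homomorphism on Y, hence on all of A.
    Φ-reflects : ∀ {u v} → Φ u ~ Φ v → u ~ v
    Φ-reflects {u} {v} Φu~Φv j = begin
      enum (u j)  ≈⟨ Laws.sym B (hom-on-X u j) ⟩
      hom u (X j) ≈⟨ homs-agree A B (hom-isHom u) (hom-isHom v) agree-on-Y (genY (X j)) ⟩
      hom v (X j) ≈⟨ hom-on-X v j ⟩
      enum (v j)  ∎
      where
      agree-on-Y : ∀ i → hom u (Y i) B.≈ hom v (Y i)
      agree-on-Y i = begin
        hom u (Y i)    ≈⟨ Laws.sym B (index-correct _) ⟩
        enum (Φ u i)   ≈⟨ Φu~Φv i ⟩
        enum (Φ v i)   ≈⟨ index-correct _ ⟩
        hom v (Y i)    ∎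

    preimage : ∃ λ w → (index ∘ ρ) ~ Φ w
    preimage = reflecting-endomap-surjective _~_ funToFin code-injective Φ Φ-reflects (index ∘ ρ)

    w : Code
    w = proj₁ preimage

    hom-w-on-Y : ∀ i → hom w (Y i) B.≈ ρ i
    hom-w-on-Y i = begin
      hom w (Y i)        ≈⟨ Laws.sym B (index-correct _) ⟩
      enum (Φ w i)       ≈⟨ Laws.sym B (proj₂ preimage i) ⟩
      enum (index (ρ i)) ≈⟨ index-correct (ρ i) ⟩
      ρ i                ∎

  extend-assignment : ∀ {c ℓ} (B : BLO ar c ℓ) {n} → (Fin n → BLO.Carrier B) → ℕ → BLO.Carrier B
  extend-assignment B {zero}  f _       = BLO.𝟘 B
  extend-assignment B {suc n} f zero    = f F.zero
  extend-assignment B {suc n} f (suc x) = extend-assignment B (f ∘ F.suc) x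

  extend-assignment-toℕ : ∀ {c ℓ} (B : BLO ar c ℓ) {n} (f : Fin n → BLO.Carrier B) (i : Fin n) →
                          extend-assignment B f (toℕ i) ≡ f i
  extend-assignment-toℕ B f F.zero    = ≡.refl
  extend-assignment-toℕ B f (F.suc i) = extend-assignment-toℕ B (f ∘ F.suc) i

  valid⇒satisfies : ∀ {c ℓ} (B : BLO ar c ℓ) {n} (s t : Term ar (Fin n)) →
                    ValidIn B s t → Satisfies ar B (rename toℕ s) (rename toℕ t)
  valid⇒satisfies B s t valid ρ = begin
    eval B (rename toℕ s) ρ ≈⟨ eval-rename B toℕ s ρ ⟩
    eval B s (ρ ∘ toℕ)      ≈⟨ valid (ρ ∘ toℕ) ⟩
    eval B t (ρ ∘ toℕ)      ≈⟨ Laws.sym B (eval-rename B toℕ t ρ) ⟩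
    eval B (rename toℕ t) ρ ∎
    where open SetoidReasoning (Laws.setoid B)

  satisfies⇒valid : ∀ {c ℓ} (B : BLO ar c ℓ) {n} (s t : Term ar (Fin n)) →
                    Satisfies ar B (rename toℕ s) (rename toℕ t) → ValidIn B s t
  satisfies⇒valid B s t satisfied f = begin
    eval B s f                  ≈⟨ Laws.eval-cong B s (Laws.reflexive B ∘ ≡.sym ∘ f-restricts) ⟩
    eval B s (ρ ∘ toℕ)          ≈⟨ Laws.sym B (eval-rename B toℕ s ρ) ⟩
    eval B (rename toℕ s) ρ     ≈⟨ satisfied ρ ⟩
    eval B (rename toℕ t) ρ     ≈⟨ eval-rename B toℕ t ρ ⟩
    eval B t (ρ ∘ toℕ)          ≈⟨ Laws.eval-cong B t (Laws.reflexive B ∘ f-restricts) ⟩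
    eval B t f                  ∎
    where
    open SetoidReasoning (Laws.setoid B)
    ρ : ℕ → BLO.Carrier B
    ρ = extend-assignment B f
    f-restricts : ∀ i → ρ (toℕ i) ≡ f i
    f-restricts = extend-assignment-toℕ B f

  finite-members-suffice :
    ∀ {E : Identities ar} → GeneratedByFiniteMembers ar E →
    ∀ {n} (s t : Term ar (Fin n)) →
    (∀ {c ℓ} (C : BLO ar c ℓ) → Finite ar C → _∈V_ ar C E → ValidIn C s t) →
    ∀ {c ℓ} (B : BLO ar c ℓ) → _∈V_ ar B E → ValidIn B s t
  finite-members-suffice {E} generated s t valid-in-finite B B∈K =
    satisfies⇒valid B s t (generated (rename toℕ s) (rename toℕ t) satisfied-in-finite B B∈K)
    where
    satisfied-in-finite : ∀ {c ℓ} (C : BLO ar c ℓ) → Finite ar C → _∈V_ ar C E →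
                          Satisfies ar C (rename toℕ s) (rename toℕ t)
    satisfied-in-finite C C-finite C∈K = valid⇒satisfies C s t (valid-in-finite C C-finite C∈K)

mainTheorem1 : {k : ℕ} (ar : Fin k → ℕ) (E : Identities ar) →
    GeneratedByFiniteMembers ar E →
    ∀ {c ℓ} (A : BLO ar c ℓ) {n : ℕ} (X Y : Fin n → BLO.Carrier A) →
    InjectiveFamily ar A X →
    FreelyGenerated ar E A X →
    InjectiveFamily ar A Y →
    Generates ar A Y →
    FreelyGenerated ar E A Y
mainTheorem1 ar E generated A X Y _ X-free _ genY = record
  { inK       = inK
  ; generates = genY
  ; universal = λ B B∈K → relations⇒extension genY (relations-hold B B∈K)
  }
  where
  open FreelyGenerated X-free using (inK; universal)

  relations-hold : ∀ {c ℓ} (B : BLO ar c ℓ) → _∈V_ ar B E → RelationsHoldIn A Y B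
  relations-hold B B∈K s t relation = finite-members-suffice generated s t
    (λ C C-finite C∈K →
      extension⇒relations (finite-extension (universal C C∈K) genY C-finite) s t relation)
    B B∈K
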